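{- For any integers $m\ge 0$ and $h,n>0$, we have $\sum_{j\ge h}\binom{m}{jn}\ge 2^{m-hn+1}-1$. -}

module Defs where

open import Data.Nat using (ℕ; _+_; _*_; suc)
open import Data.Nat.Combinatorics using (_C_)
open import Data.List using (map; upTo)
open import Data.Nat.ListAction using (sum)

-- tailSum m h n = Σ_{j ≥ h} C(m, j·n).
-- For n ≥ 1, every j with j·n ≤ m satisfies j ≤ m, and C(m,k) = 0 for k > m,
-- so the (formally infinite) sum equals the finite sum over j = h + i, 0 ≤ i ≤ m.
tailSum : ℕ → ℕ → ℕ → ℕ
tailSum m h n = sum (map (λ i → m C ((h + i) * n)) (upTo (suc m)))

{-# OPTIONS --safe #-}
-- Write m + 1 = hn + M.  Then 2^M = Σₛ C(M,s); split the terms with s ≥ 1 into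
-- blocks of n consecutive indices.  By Pascal's rule n consecutive coefficients
-- C(M,x), …, C(M,x+n-1) sum to at most C(M+n-1, x+n-1), and shifting both
-- arguments of a binomial coefficient up by (h-1)n does not decrease it, so the
-- q-th block is at most C(m, (h+q)n).
module Submission where

open import Defs
open import Data.Nat using (ℕ; _+_; _*_; _^_; _≤_; _<_; _∸_; suc; zero; z≤n; s≤s)
open import Data.Nat.Properties
open import Data.Nat.Combinatorics using (_C_; nCk+nC[k+1]≡[n+1]C[k+1]; k>n⇒nCk≡0)
open import Data.Nat.ListAction using (sum)
open import Data.Nat.Tactic.RingSolver using (solve-∀)
open import Data.List using (applyUpTo)
open import Data.List.Properties using (map-upTo)
open import Function using (_∘_)
open import Data.Sum using (inj₁; inj₂)
open import Algebra.Properties.CommutativeSemigroup +-commutativeSemigroup using (interchange; x∙yz≈y∙xz)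
open import Relation.Binary.PropositionalEquality

∑< : ℕ → (ℕ → ℕ) → ℕ
∑< n f = sum (applyUpTo f n)

infix 6.4 ∑<
syntax ∑< n (λ i → e) = ∑[ i < n ] e

∑-cong : ∀ {f g : ℕ → ℕ} → (∀ i → f i ≡ g i) → ∀ n → ∑< n f ≡ ∑< n g
∑-cong f≡g zero    = refl
∑-cong f≡g (suc n) = cong₂ _+_ (f≡g 0) (∑-cong (f≡g ∘ suc) n)

∑-monoʳ-≤ : ∀ {f g : ℕ → ℕ} → (∀ i → f i ≤ g i) → ∀ n → ∑< n f ≤ ∑< n g
∑-monoʳ-≤ f≤g zero    = z≤n
∑-monoʳ-≤ f≤g (suc n) = +-mono-≤ (f≤g 0) (∑-monoʳ-≤ (f≤g ∘ suc) n)

∑-distrib-+ : ∀ (f g : ℕ → ℕ) n → ∑[ i < n ] (f i + g i) ≡ ∑< n f + ∑< n g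
∑-distrib-+ f g zero    = refl
∑-distrib-+ f g (suc n) = begin
  f 0 + g 0 + ∑[ i < n ] (f (suc i) + g (suc i))
    ≡⟨ cong (f 0 + g 0 +_) (∑-distrib-+ (λ i → f (suc i)) (λ i → g (suc i)) n) ⟩
  f 0 + g 0 + (∑[ i < n ] f (suc i) + ∑[ i < n ] g (suc i))
    ≡⟨ interchange (f 0) (g 0) _ _ ⟩
  ∑< (suc n) f + ∑< (suc n) g
    ∎
  where open ≡-Reasoning

∑-last : ∀ (f : ℕ → ℕ) n → ∑< (suc n) f ≡ ∑< n f + f n
∑-last f zero    = +-identityʳ (f 0)
∑-last f (suc n) = trans (cong (f 0 +_) (∑-last (λ i → f (suc i)) n)) (sym (+-assoc (f 0) _ _))

∑-monoˡ-≤ : ∀ (f : ℕ → ℕ) {a b} → a ≤ b → ∑< a f ≤ ∑< b f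
∑-monoˡ-≤ f z≤n       = z≤n
∑-monoˡ-≤ f (s≤s a≤b) = +-monoʳ-≤ (f 0) (∑-monoˡ-≤ (λ i → f (suc i)) a≤b)

∑-split : ∀ (f : ℕ → ℕ) a b → ∑< (a + b) f ≡ ∑< a f + ∑[ i < b ] f (a + i)
∑-split f zero    b = refl
∑-split f (suc a) b =
  trans (cong (f 0 +_) (∑-split (λ i → f (suc i)) a b)) (sym (+-assoc (f 0) _ _))

∑-blocks : ∀ (f : ℕ → ℕ) n k → ∑[ q < k ] ∑[ i < n ] f (q * n + i) ≡ ∑< (k * n) f
∑-blocks f n zero    = refl
∑-blocks f n (suc k) = begin
  ∑[ i < n ] f (0 * n + i) + ∑[ q < k ] ∑[ i < n ] f (n + q * n + i)
    ≡⟨ cong (∑< n f +_) (∑-cong (λ q → ∑-cong (λ i → cong f (+-assoc n (q * n) i)) n) k) ⟩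
  ∑< n f + ∑[ q < k ] ∑[ i < n ] f (n + (q * n + i))
    ≡⟨ cong (∑< n f +_) (∑-blocks (λ j → f (n + j)) n k) ⟩
  ∑< n f + ∑[ j < k * n ] f (n + j)
    ≡⟨ ∑-split f n (k * n) ⟨
  ∑< (n + k * n) f
    ∎
  where open ≡-Reasoning

pascal : ∀ n k → suc n C suc k ≡ n C k + n C suc k
pascal n k = sym (nCk+nC[k+1]≡[n+1]C[k+1] n k)

∑nCk≡2^n : ∀ n → ∑[ k < suc n ] n C k ≡ 2 ^ n
∑nCk≡2^n zero    = refl
∑nCk≡2^n (suc n) = begin
  1 + ∑[ k < suc n ] suc n C suc k
    ≡⟨ cong (1 +_) (∑-cong (pascal n) (suc n)) ⟩
  1 + ∑[ k < suc n ] (n C k + n C suc k)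
    ≡⟨ cong (1 +_) (∑-distrib-+ (n C_) (λ k → n C suc k) (suc n)) ⟩
  1 + (∑[ k < suc n ] n C k + ∑[ k < suc n ] n C suc k)
    ≡⟨ x∙yz≈y∙xz 1 (∑[ k < suc n ] n C k) _ ⟩
  ∑[ k < suc n ] n C k + ∑[ k < suc (suc n) ] n C k
    ≡⟨ cong (∑[ k < suc n ] n C k +_) (∑-last (n C_) (suc n)) ⟩
  ∑[ k < suc n ] n C k + (∑[ k < suc n ] n C k + n C suc n)
    ≡⟨ cong₂ (λ s t → s + (s + t)) (∑nCk≡2^n n) (k>n⇒nCk≡0 (n<1+n n)) ⟩
  2 ^ n + (2 ^ n + 0)
    ∎
  where open ≡-Reasoning

nCk≤[a+n]C[a+k] : ∀ a n k → n C k ≤ (a + n) C (a + k)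
nCk≤[a+n]C[a+k] zero    n k = ≤-refl
nCk≤[a+n]C[a+k] (suc a) n k = begin
  n C k                                         ≤⟨ nCk≤[a+n]C[a+k] a n k ⟩
  (a + n) C (a + k)                             ≤⟨ m≤m+n _ _ ⟩
  (a + n) C (a + k) + (a + n) C suc (a + k)     ≡⟨ pascal (a + n) (a + k) ⟨
  (suc a + n) C (suc a + k)                     ∎
  where open ≤-Reasoning

∑nC[k+i]≤[a+n]C[k+a] : ∀ a n k → ∑[ i < suc a ] n C (k + i) ≤ (a + n) C (k + a)
∑nC[k+i]≤[a+n]C[k+a] zero    n k = ≤-reflexive (+-identityʳ (n C (k + 0)))
∑nC[k+i]≤[a+n]C[k+a] (suc a) n k = begin
  n C (k + 0) + ∑[ i < suc a ] n C (k + suc i)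
    ≡⟨ cong₂ _+_ (cong (n C_) (+-identityʳ k)) (∑-cong (cong (n C_) ∘ +-suc k) (suc a)) ⟩
  n C k + ∑[ i < suc a ] n C (suc k + i)
    ≤⟨ +-mono-≤ (nCk≤[a+n]C[a+k] a n k) (∑nC[k+i]≤[a+n]C[k+a] a n (suc k)) ⟩
  (a + n) C (a + k) + (a + n) C suc (k + a)
    ≡⟨ cong (λ j → (a + n) C j + (a + n) C suc (k + a)) (+-comm a k) ⟩
  (a + n) C (k + a) + (a + n) C suc (k + a)
    ≡⟨ pascal (a + n) (k + a) ⟨
  (suc a + n) C suc (k + a)
    ≡⟨ cong ((suc a + n) C_) (+-suc k a) ⟨
  (suc a + n) C (k + suc a)
    ∎
  where open ≤-Reasoning

tailSum≡∑ : ∀ m h n → tailSum m h n ≡ ∑[ q < suc m ] m C ((h + q) * n)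
tailSum≡∑ m h n = cong sum (map-upTo (λ q → m C ((h + q) * n)) (suc m))

2^M≤tailSum+1 : ∀ m g k M → suc g * suc k + M ≡ m + 1 →
                2 ^ M ≤ tailSum m (suc g) (suc k) + 1
2^M≤tailSum+1 m g k M hn+M≡m+1 = begin
  2 ^ M
    ≡⟨ ∑nCk≡2^n M ⟨
  1 + ∑[ s < M ] M C suc s
    ≤⟨ +-monoʳ-≤ 1 (∑-monoˡ-≤ (λ s → M C suc s) M≤[m+1]n) ⟩
  1 + ∑[ s < suc m * n ] M C suc s
    ≡⟨ cong (1 +_) (∑-blocks (λ s → M C suc s) n (suc m)) ⟨
  1 + ∑[ q < suc m ] ∑[ i < n ] M C suc (q * n + i)
    ≤⟨ +-monoʳ-≤ 1 (∑-monoʳ-≤ block≤ (suc m)) ⟩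
  1 + ∑[ q < suc m ] m C ((suc g + q) * n)
    ≡⟨ cong (1 +_) (tailSum≡∑ m (suc g) n) ⟨
  1 + tailSum m (suc g) n
    ≡⟨ +-comm 1 _ ⟩
  tailSum m (suc g) n + 1
    ∎
  where
  open ≤-Reasoning
  n : ℕ
  n = suc k

  m≡gn+[k+M] : m ≡ g * n + (k + M)
  m≡gn+[k+M] = suc-injective (begin-equality
    suc m                 ≡⟨ +-comm m 1 ⟨
    m + 1                 ≡⟨ hn+M≡m+1 ⟨
    suc g * n + M         ≡⟨ expand g k M ⟩
    suc (g * n + (k + M)) ∎)
    where
    expand : ∀ g k M → suc g * suc k + M ≡ suc (g * suc k + (k + M))
    expand = solve-∀

  M≤[m+1]n : M ≤ suc m * n
  M≤[m+1]n = begin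
    M              ≤⟨ m≤n+m M (suc g * n) ⟩
    suc g * n + M  ≡⟨ trans hn+M≡m+1 (+-comm m 1) ⟩
    suc m          ≤⟨ m≤m*n (suc m) n ⟩
    suc m * n      ∎

  block≤ : ∀ q → ∑[ i < n ] M C suc (q * n + i) ≤ m C ((suc g + q) * n)
  block≤ q = begin
    ∑[ i < n ] M C (suc (q * n) + i)
      ≤⟨ ∑nC[k+i]≤[a+n]C[k+a] k M (suc (q * n)) ⟩
    (k + M) C (suc (q * n) + k)
      ≤⟨ nCk≤[a+n]C[a+k] (g * n) (k + M) (suc (q * n) + k) ⟩
    (g * n + (k + M)) C (g * n + (suc (q * n) + k))
      ≡⟨ cong₂ _C_ m≡gn+[k+M] (expand g k q) ⟨
    m C ((suc g + q) * n)
      ∎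
    where
    expand : ∀ g k q → (suc g + q) * suc k ≡ g * suc k + (suc (q * suc k) + k)
    expand = solve-∀

mainTheorem6 : (m h n : ℕ) → 0 < h → 0 < n →
    2 ^ (m + 1) ≤ 2 ^ (h * n) * (tailSum m h n + 1)
mainTheorem6 m h@(suc g) n@(suc k) _ _ with ≤-total (m + 1) (h * n)
... | inj₁ m+1≤hn = begin
  2 ^ (m + 1)                    ≤⟨ ^-monoʳ-≤ 2 m+1≤hn ⟩
  2 ^ (h * n)                    ≡⟨ *-identityʳ _ ⟨
  2 ^ (h * n) * 1                ≤⟨ *-monoʳ-≤ (2 ^ (h * n)) (m≤n+m 1 (tailSum m h n)) ⟩
  2 ^ (h * n) * (tailSum m h n + 1) ∎
  where open ≤-Reasoning
... | inj₂ hn≤m+1 = begin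
  2 ^ (m + 1)                    ≡⟨ cong (2 ^_) hn+M≡m+1 ⟨
  2 ^ (h * n + M)                ≡⟨ ^-distribˡ-+-* 2 (h * n) M ⟩
  2 ^ (h * n) * 2 ^ M            ≤⟨ *-monoʳ-≤ (2 ^ (h * n)) (2^M≤tailSum+1 m g k M hn+M≡m+1) ⟩
  2 ^ (h * n) * (tailSum m h n + 1) ∎
  where
  open ≤-Reasoning
  M : ℕ
  M = m + 1 ∸ h * n
  hn+M≡m+1 : h * n + M ≡ m + 1
  hn+M≡m+1 = m+[n∸m]≡n hn≤m+1
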